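{- Let $G=(V,E)$ be a $2$-edge-connected undirected unweighted graph and let $T$ be a spanning tree of $G$. Fix an edge $e$ of $T$, let $X$ be the vertex set of one of the two connected components of $T-e$, let $Y=V\setminus X$, and let $S_e$ be the set of swap edges of $e$. Write every $g\in S_e$ as $g=(a,b)$ with $a\in X$, $b\in Y$. For $x\in X$ and $g=(a,b),g'=(a',b')\in S_e$ (not necessarily distinct) let $$\phi_x(g,g')=d_T(x,a)+d_T(b,b')+d_T(a',x).$$ For every $x\in X$ fix a pair $(g_x,g'_x)\in \arg\max_{(g,g')\in S_e^2}\phi_x(g,g')$, and write $g_x=(a_x,b_x)$, $g'_x=(a'_x,b'_x)$ with $a_x,a'_x\in X$, $b_x,b'_x\in Y$. Let $T_X$ be the subtree of $T$ induced by $X$; for an edge $e'=(x,z)$ of $T_X$, let $U(e',x)$ and $U(e',z)$ be the vertex sets of the two components of $T_X-e'$ containing $x$ and $z$ respectively. Then for every edge $e'=(x,z)\in E(T_X)$ with $\phi_z(g_x,g'_x)<\phi_z(g_z,g'_z)$, at least one of the following holds: (i) $a_z,a'_z\in U(e',x)$ and $\{a_x,a'_x\}\cap U(e',z)\neq\emptyset$; (ii) $a_x,a'_x\in U(e',z)$ and $\{a_z,a'_z\}\cap U(e',x)\neq\emptyset$.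
   Context: $d_T(u,v)$ denotes the number of edges on the unique path between $u$ and $v$ in $T$. For an edge $e$ of $T$, the swap edges of $e$ are the edges of $E\setminus\{e\}$ whose endpoints lie in different connected components of $T-e$. -}

module Defs where

open import Data.Nat using (ℕ; zero; suc; _+_; _≤_; _<_)
open import Data.Fin using (Fin)
open import Data.List using (List; []; _∷_)
open import Data.List.Relation.Unary.Unique.Propositional using (Unique)
open import Data.Product using (Σ; ∃; _×_; _,_)
open import Data.Sum using (_⊎_)
open import Relation.Nullary using (¬_)
open import Relation.Binary.PropositionalEquality using (_≡_)

VRel : ℕ → Set₁
VRel n = Fin n → Fin n → Set

record Graph (n : ℕ) : Set₁ where
  field
    Adj    : VRel n
    sym    : ∀ {u v} → Adj u v → Adj v u
    irrefl : ∀ {u} → ¬ Adj u u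
open Graph public

data Walk {n : ℕ} (R : VRel n) : Fin n → Fin n → Set where
  []  : ∀ {u} → Walk R u u
  _∷_ : ∀ {u v w} → R u v → Walk R v w → Walk R u w

len : ∀ {n} {R : VRel n} {u v} → Walk R u v → ℕ
len []      = zero
len (_ ∷ w) = suc (len w)

verts : ∀ {n} {R : VRel n} {u v} → Walk R u v → List (Fin n)
verts {u = u} []      = u ∷ []
verts {u = u} (_ ∷ w) = u ∷ verts w

IsPath : ∀ {n} {R : VRel n} {u v} → Walk R u v → Set
IsPath w = Unique (verts w)

Connected : ∀ {n} → VRel n → Set
Connected R = ∀ u v → Walk R u v

removeEdge : ∀ {n} → VRel n → Fin n → Fin n → VRel n
removeEdge R p q x y = R x y × ¬ ((x ≡ p × y ≡ q) ⊎ (x ≡ q × y ≡ p))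

induced : ∀ {n} → VRel n → (Fin n → Set) → VRel n
induced R X x y = R x y × X x × X y

TwoEdgeConnected : ∀ {n} → Graph n → Set
TwoEdgeConnected G =
  Connected (Adj G) × (∀ p q → Adj G p q → Connected (removeEdge (Adj G) p q))

HasCycle : ∀ {n} → VRel n → Set
HasCycle R = ∃ λ u → ∃ λ v → R u v × Σ (Walk R v u) (λ w → IsPath w × 2 ≤ len w)

Acyclic : ∀ {n} → VRel n → Set
Acyclic R = ¬ HasCycle R

IsSpanningTree : ∀ {n} → Graph n → Graph n → Set
IsSpanningTree G T =
  (∀ {u v} → Adj T u v → Adj G u v) × Connected (Adj T) × Acyclic (Adj T)

-- d is d_T: d u v is the number of edges of the (unique) path from u to v in T
IsTreeDist : ∀ {n} → Graph n → (Fin n → Fin n → ℕ) → Set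
IsTreeDist T d = ∀ u v → Σ (Walk (Adj T) u v) (λ w → IsPath w × len w ≡ d u v)

-- a swap edge of the tree edge e = (p,q) (p ∈ X, q ∉ X), written (a,b) with a ∈ X, b ∈ Y
record SwapEdge {n : ℕ} (G : Graph n) (X : Fin n → Set) (p q : Fin n) : Set where
  constructor swap
  field
    a    : Fin n
    b    : Fin n
    edge : Adj G a b
    aX   : X a
    bY   : ¬ X b
    notE : ¬ (a ≡ p × b ≡ q)
open SwapEdge public

φ : ∀ {n} {G : Graph n} {X : Fin n → Set} {p q : Fin n} →
    (Fin n → Fin n → ℕ) → Fin n → SwapEdge G X p q → SwapEdge G X p q → ℕ
φ d x g g' = d x (a g) + d (b g) (b g') + d (a g') x

module Submission where

-- In a tree, every vertex v of X lies on one side of the edge x–z: either v is reached from x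
-- inside T_X − xz and d(z,v) = d(x,v) + 1, or symmetrically with x and z exchanged. Adding the
-- maximality of (g_x, g'_x) at x to the strict inequality at z, the terms d(b,b') cancel, and
-- what remains says that a_z, a'_z, a_x, a'_x contribute ±1 each according to their sides, with
-- positive total. Of the sixteen side patterns, only those listed in (i) and (ii) achieve this.

open import Defs
open import Data.Nat using (ℕ; suc; _+_; _≤_; _<_; _≤?_; z≤n; s≤s)
open import Data.Nat.Properties
  using (≤-refl; ≤-trans; +-comm; +-identityʳ; ≤-antisym; m≤n⇒m≤1+n; ≤⇒≯; +-mono-≤-<; +-monoˡ-<; +-cancelˡ-<; +-cancelʳ-<)
open import Data.Nat.Tactic.RingSolver using (solve-∀)
open import Data.Fin using (Fin)
open import Data.Fin.Properties using (_≟_)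
open import Data.Product using (Σ; _×_; _,_; proj₁; proj₂)
open import Data.Sum using (_⊎_; inj₁; inj₂)
open import Data.Empty using (⊥-elim)
open import Data.List using ([]; _∷_)
open import Data.List.Relation.Unary.Any using (here; there; any?)
open import Data.List.Relation.Unary.All using ([]; _∷_)
import Data.List.Relation.Unary.All as All
open import Data.List.Relation.Unary.All.Properties using (¬Any⇒All¬)
open import Data.List.Relation.Unary.AllPairs using ([]; _∷_)
open import Data.List.Membership.Propositional using (_∈_)
open import Data.List.Relation.Binary.Subset.Propositional using (_⊆_)
open import Data.List.Relation.Unary.Unique.Propositional using (Unique)
open import Relation.Binary.Core using (_⇒_)
open import Relation.Binary.Definitions using (Symmetric)
open import Relation.Nullary using (¬_; yes; no)
open import Relation.Nullary.Decidable using (True; toWitness)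
open import Relation.Binary.PropositionalEquality as ≡
  using (_≡_; refl; trans; cong; cong₂; subst; subst₂)

module _ {n : ℕ} {R : VRel n} where

  _++ʷ_ : ∀ {u v w} → Walk R u v → Walk R v w → Walk R u w
  []      ++ʷ W = W
  (e ∷ V) ++ʷ W = e ∷ (V ++ʷ W)

  len-++ʷ : ∀ {u v w} (V : Walk R u v) (W : Walk R v w) → len (V ++ʷ W) ≡ len V + len W
  len-++ʷ []      W = refl
  len-++ʷ (e ∷ V) W = cong suc (len-++ʷ V W)

  ∈-++ʷ⁻ : ∀ {u v w y} (V : Walk R u v) (W : Walk R v w) →
           y ∈ verts (V ++ʷ W) → y ∈ verts V ⊎ y ∈ verts W
  ∈-++ʷ⁻ []      W y∈W         = inj₂ y∈W
  ∈-++ʷ⁻ (e ∷ V) W (here refl) = inj₁ (here refl)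
  ∈-++ʷ⁻ (e ∷ V) W (there y∈)  with ∈-++ʷ⁻ V W y∈
  ... | inj₁ y∈V = inj₁ (there y∈V)
  ... | inj₂ y∈W = inj₂ y∈W

  head∈ : ∀ {u v} (W : Walk R u v) → u ∈ verts W
  head∈ []      = here refl
  head∈ (_ ∷ _) = here refl

  last∈ : ∀ {u v} (W : Walk R u v) → v ∈ verts W
  last∈ []      = here refl
  last∈ (_ ∷ W) = there (last∈ W)

  suffix : ∀ {u v y} (W : Walk R u v) → y ∈ verts W →
           Σ (Walk R y v) λ W′ → verts W′ ⊆ verts W × len W′ ≤ len W × (IsPath W → IsPath W′)
  suffix []      (here refl) = [] , (λ t∈ → t∈) , ≤-refl , (λ W-path → W-path)
  suffix (e ∷ W) (here refl) = e ∷ W , (λ t∈ → t∈) , ≤-refl , (λ W-path → W-path)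
  suffix (e ∷ W) (there y∈W) with suffix W y∈W
  ... | W′ , W′⊆W , W′≤W , path =
    W′ , (λ t∈ → there (W′⊆W t∈)) , m≤n⇒m≤1+n W′≤W , λ { (_ ∷ W-path) → path W-path }

  toPath : ∀ {u v} (W : Walk R u v) → Σ (Walk R u v) λ P → IsPath P × len P ≤ len W
  toPath [] = [] , [] ∷ [] , z≤n
  toPath {u} (e ∷ W) with toPath W
  ... | P , P-path , P≤W with any? (u ≟_) (verts P)
  ...   | yes u∈P = let P′ , _ , P′≤P , path = suffix P u∈P
                    in P′ , path P-path , m≤n⇒m≤1+n (≤-trans P′≤P P≤W)
  ...   | no  u∉P = e ∷ P , ¬Any⇒All¬ (verts P) u∉P ∷ P-path , s≤s P≤W

  suffix-avoiding-start : ∀ {u v y} (P : Walk R u v) → IsPath P → y ∈ verts P → ¬ u ≡ y →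
                          Σ (Walk R y v) λ Q → IsPath Q × ¬ u ∈ verts Q
  suffix-avoiding-start []      _              (here refl) u≢y = ⊥-elim (u≢y refl)
  suffix-avoiding-start (_ ∷ _) _              (here refl) u≢y = ⊥-elim (u≢y refl)
  suffix-avoiding-start (e ∷ P) (u∉P ∷ P-path) (there y∈P) _ =
    let Q , Q⊆P , _ , path = suffix P y∈P
    in Q , path P-path , λ u∈Q → All.lookup u∉P (Q⊆P u∈Q) refl

module _ {n : ℕ} {R S : VRel n} (f : R ⇒ S) where

  mapʷ : ∀ {u v} → Walk R u v → Walk S u v
  mapʷ []      = []
  mapʷ (e ∷ W) = f e ∷ mapʷ W

  verts-mapʷ : ∀ {u v} (W : Walk R u v) → verts (mapʷ W) ≡ verts W
  verts-mapʷ []      = refl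
  verts-mapʷ (e ∷ W) = cong (_ ∷_) (verts-mapʷ W)

  len-mapʷ : ∀ {u v} (W : Walk R u v) → len (mapʷ W) ≡ len W
  len-mapʷ []      = refl
  len-mapʷ (e ∷ W) = cong suc (len-mapʷ W)

  IsPath-mapʷ : ∀ {u v} {W : Walk R u v} → IsPath W → IsPath (mapʷ W)
  IsPath-mapʷ {W = W} = subst Unique (≡.sym (verts-mapʷ W))

module _ {n : ℕ} {R : VRel n} (R-sym : Symmetric R) where

  reverseʷ : ∀ {u v} → Walk R u v → Walk R v u
  reverseʷ []      = []
  reverseʷ (e ∷ W) = reverseʷ W ++ʷ (R-sym e ∷ [])

  ∈-reverseʷ⁻ : ∀ {u v y} (W : Walk R u v) → y ∈ verts (reverseʷ W) → y ∈ verts W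
  ∈-reverseʷ⁻ []      y∈ = y∈
  ∈-reverseʷ⁻ (e ∷ W) y∈ with ∈-++ʷ⁻ (reverseʷ W) (R-sym e ∷ []) y∈
  ... | inj₁ y∈W                = there (∈-reverseʷ⁻ W y∈W)
  ... | inj₂ (here refl)         = there (head∈ W)
  ... | inj₂ (there (here refl)) = here refl

  len-reverseʷ : ∀ {u v} (W : Walk R u v) → len (reverseʷ W) ≡ len W
  len-reverseʷ []      = refl
  len-reverseʷ (e ∷ W) = trans (len-++ʷ (reverseʷ W) _) (trans (+-comm (len (reverseʷ W)) 1) (cong suc (len-reverseʷ W)))

removeEdge-sym : ∀ {n} {R : VRel n} {p q} → Symmetric R → Symmetric (removeEdge R p q)
removeEdge-sym R-sym (e , e≢pq) =
  R-sym e , λ { (inj₁ (v≡p , u≡q)) → e≢pq (inj₂ (u≡q , v≡p))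
              ; (inj₂ (v≡q , u≡p)) → e≢pq (inj₁ (u≡p , v≡q)) }

edge-at-endpoint : ∀ {n} {p q y u v : Fin n} → y ≡ p ⊎ y ≡ q → ¬ y ≡ u → ¬ y ≡ v →
                   ¬ ((u ≡ p × v ≡ q) ⊎ (u ≡ q × v ≡ p))
edge-at-endpoint (inj₁ refl) y≢u y≢v (inj₁ (refl , refl)) = y≢u refl
edge-at-endpoint (inj₂ refl) y≢u y≢v (inj₁ (refl , refl)) = y≢v refl
edge-at-endpoint (inj₁ refl) y≢u y≢v (inj₂ (refl , refl)) = y≢v refl
edge-at-endpoint (inj₂ refl) y≢u y≢v (inj₂ (refl , refl)) = y≢u refl

module _ {n : ℕ} {S : VRel n} {p q y : Fin n} (y-end : y ≡ p ⊎ y ≡ q) where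

  avoid-removeEdge : ∀ {u v} (W : Walk S u v) → ¬ y ∈ verts W → Walk (removeEdge S p q) u v
  avoid-removeEdge []      _   = []
  avoid-removeEdge (e ∷ W) y∉ =
    (e , edge-at-endpoint y-end (λ { refl → y∉ (here refl) }) (λ { refl → y∉ (there (head∈ W)) }))
    ∷ avoid-removeEdge W (λ y∈W → y∉ (there y∈W))

module Tree {n : ℕ} (T : Graph n) (acyclic : Acyclic (Adj T)) where

  detour⇒cycle : ∀ {u x} → Adj T u x → Walk (removeEdge (Adj T) u x) x u → HasCycle (Adj T)
  detour⇒cycle {u} {x} e W =
    let C , C-path , _ = toPath W
    in u , x , e , mapʷ proj₁ C , IsPath-mapʷ proj₁ C-path ,
       subst (2 ≤_) (≡.sym (len-mapʷ proj₁ C)) (two-edges C)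
    where
    -- the removed edge u–x rules out a one-edge detour
    two-edges : (C : Walk (removeEdge (Adj T) u x) x u) → 2 ≤ len C
    two-edges []          = ⊥-elim (irrefl T e)
    two-edges (g ∷ [])    = ⊥-elim (proj₂ g (inj₂ (refl , refl)))
    two-edges (_ ∷ _ ∷ _) = s≤s (s≤s z≤n)

  -- Two paths leaving u through different neighbours x ≠ y close up, through v, into a
  -- detour from x back to u avoiding the edge u–x.
  path-len-unique : ∀ {u v} (P Q : Walk (Adj T) u v) → IsPath P → IsPath Q → len P ≡ len Q
  path-len-unique []      []      _            _            = refl
  path-len-unique []      (f ∷ Q) _            (u∉Q ∷ _)    = ⊥-elim (All.lookup u∉Q (last∈ Q) refl)
  path-len-unique (e ∷ P) []      (u∉P ∷ _)    _            = ⊥-elim (All.lookup u∉P (last∈ P) refl)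
  path-len-unique {u} (_∷_ {v = x} e P) (_∷_ {v = y} f Q) (u∉P ∷ P-path) (u∉Q ∷ Q-path) with x ≟ y
  ... | yes refl = cong suc (path-len-unique P Q P-path Q-path)
  ... | no  x≢y  = ⊥-elim (acyclic (detour⇒cycle e (avoid-removeEdge (inj₁ refl) x⇝y u∉x⇝y ++ʷ (y→u ∷ []))))
    where
    x⇝y : Walk (Adj T) x y
    x⇝y = P ++ʷ reverseʷ (sym T) Q
    u∉x⇝y : ¬ u ∈ verts x⇝y
    u∉x⇝y u∈ with ∈-++ʷ⁻ P (reverseʷ (sym T) Q) u∈
    ... | inj₁ u∈P = All.lookup u∉P u∈P refl
    ... | inj₂ u∈Q = All.lookup u∉Q (∈-reverseʷ⁻ (sym T) Q u∈Q) refl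
    y→u : removeEdge (Adj T) u x y u
    y→u = sym T f , λ { (inj₁ (refl , _)) → irrefl T f ; (inj₂ (y≡x , _)) → x≢y (≡.sym y≡x) }

  module Distance (d : Fin n → Fin n → ℕ) (d-tree : IsTreeDist T d) where

    len≡d : ∀ {S : VRel n} (f : S ⇒ Adj T) {u v} (P : Walk S u v) → IsPath P → len P ≡ d u v
    len≡d f {u} {v} P P-path =
      let Q , Q-path , Q≡d = d-tree u v
      in trans (≡.sym (len-mapʷ f P)) (trans (path-len-unique (mapʷ f P) Q (IsPath-mapʷ f P-path) Q-path) Q≡d)

    d-via-edge : ∀ {S : VRel n} (f : S ⇒ Adj T) {u w v} → S u w → (P : Walk S w v) → IsPath P →
                 ¬ u ∈ verts P → d u v ≡ suc (d w v)
    d-via-edge f e P P-path u∉P =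
      trans (≡.sym (len≡d f (e ∷ P) (¬Any⇒All¬ (verts P) u∉P ∷ P-path))) (cong suc (len≡d f P P-path))

    d-sym-≤ : ∀ u v → d v u ≤ d u v
    d-sym-≤ u v =
      let P , _ , P≡d = d-tree u v
          Q , Q-path , Q≤ = toPath (reverseʷ (sym T) P)
      in subst₂ _≤_ (len≡d (λ e → e) Q Q-path) (trans (len-reverseʷ (sym T) P) P≡d) Q≤

    d-sym : ∀ u v → d u v ≡ d v u
    d-sym u v = ≤-antisym (d-sym-≤ v u) (d-sym-≤ u v)

    φ-unfold : ∀ {G : Graph n} {X : Fin n → Set} {p q} y (g g′ : SwapEdge G X p q) →
               φ d y g g′ ≡ d y (a g) + d (b g) (b g′) + d y (a g′)
    φ-unfold y g g′ = cong (d y (a g) + d (b g) (b g′) +_) (d-sym (a g′) y)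

module Component {n : ℕ} (T : Graph n) {p q : Fin n} (X : Fin n → Set)
                 (reach : ∀ w → X w → Walk (removeEdge (Adj T) p q) p w)
                 (inX : ∀ w → Walk (removeEdge (Adj T) p q) p w → X w) where

  restrict : ∀ {u v} → X u → Walk (removeEdge (Adj T) p q) u v → Walk (induced (Adj T) X) u v
  restrict _  []      = []
  restrict {u} u∈X (_∷_ {v = w} e W) = (proj₁ e , u∈X , w∈X) ∷ restrict w∈X W
    where
    w∈X : X w
    w∈X = inX w (reach u u∈X ++ʷ (e ∷ []))

  path-in-X : ∀ {s v} → X s → X v → Σ (Walk (induced (Adj T) X) s v) IsPath
  path-in-X {s} {v} s∈X v∈X =
    let P , P-path , _ = toPath (restrict s∈X (reverseʷ (removeEdge-sym (sym T)) (reach s s∈X) ++ʷ reach v v∈X))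
    in P , P-path

≮-by-computation : ∀ {m n} {n≤m : True (n ≤? m)} → ¬ m < n
≮-by-computation {n≤m = n≤m} = ≤⇒≯ (toWitness n≤m)

<-offset : ∀ {x y p m} → x < y → x + p ≡ y + m → m < p
<-offset {x} {y} {p} {m} x<y x+p≡y+m = +-cancelˡ-< y m p (subst (_< y + p) x+p≡y+m (+-monoˡ-< p x<y))

sum-of-bounds : ∀ {a a′ b b′ c c′ e e′ k l : ℕ} →
                a + k + a′ ≤ b + l + b′ → c + l + c′ < e + k + e′ →
                (a + a′) + (c + c′) < (e + e′) + (b + b′)
sum-of-bounds {a} {a′} {b} {b′} {c} {c′} {e} {e′} {k} {l} ≤₁ <₂ =
  +-cancelʳ-< (k + l) _ _ (subst₂ _<_ (regroupˡ a a′ c c′ k l) (regroupʳ b b′ e e′ k l) (+-mono-≤-< ≤₁ <₂))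
  where
  regroupˡ : ∀ a a′ c c′ k l → (a + k + a′) + (c + l + c′) ≡ ((a + a′) + (c + c′)) + (k + l)
  regroupˡ = solve-∀
  regroupʳ : ∀ b b′ e e′ k l → (b + l + b′) + (e + k + e′) ≡ ((e + e′) + (b + b′)) + (k + l)
  regroupʳ = solve-∀

+-interleave : ∀ a b c e a′ b′ c′ e′ →
               ((a + b) + (c + e)) + ((a′ + b′) + (c′ + e′)) ≡ ((a + a′) + (b + b′)) + ((c + c′) + (e + e′))
+-interleave = solve-∀

module Sides {n : ℕ} (T : Graph n) (acyclic : Acyclic (Adj T))
             (d : Fin n → Fin n → ℕ) (d-tree : IsTreeDist T d)
             {p q : Fin n} (X : Fin n → Set)
             (reach : ∀ w → X w → Walk (removeEdge (Adj T) p q) p w)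
             (inX : ∀ w → Walk (removeEdge (Adj T) p q) p w → X w)
             {x z : Fin n} (xz : Adj T x z) (x∈X : X x) (z∈X : X z) where

  open Tree T acyclic
  open Distance d d-tree
  open Component T X reach inX

  U : Fin n → Fin n → Set
  U c w = Walk (removeEdge (induced (Adj T) X) x z) c w

  data Side (v : Fin n) : Set where
    near-x : U x v → d z v ≡ suc (d x v) → Side v
    near-z : U z v → d x v ≡ suc (d z v) → Side v

  private
    x≢z : ¬ x ≡ z
    x≢z refl = irrefl T xz

  side : ∀ {v} → X v → Side v
  side v∈X with path-in-X x∈X v∈X
  ... | P , P-path with any? (z ≟_) (verts P)
  ...   | no z∉P = near-x (avoid-removeEdge (inj₂ refl) P z∉P)
                          (d-via-edge proj₁ (sym T xz , z∈X , x∈X) P P-path z∉P)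
  ...   | yes z∈P = let Q , Q-path , x∉Q = suffix-avoiding-start P P-path z∈P x≢z
                    in near-z (avoid-removeEdge (inj₁ refl) Q x∉Q)
                              (d-via-edge proj₁ (xz , x∈X , z∈X) Q Q-path x∉Q)

  atX atZ : ∀ {v} → Side v → ℕ
  atX (near-x _ _) = 1
  atX (near-z _ _) = 0
  atZ (near-x _ _) = 0
  atZ (near-z _ _) = 1

  balance : ∀ {v} (s : Side v) → d x v + atX s ≡ d z v + atZ s
  balance (near-x _ z≡1+x) = trans (+-comm _ 1) (trans (≡.sym z≡1+x) (≡.sym (+-identityʳ _)))
  balance (near-z _ x≡1+z) = trans (+-identityʳ _) (trans x≡1+z (+-comm 1 _))

  count-< : ∀ {az az′ ax ax′ K K′} (s₁ : Side az) (s₂ : Side az′) (s₃ : Side ax) (s₄ : Side ax′) →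
            d x az + K′ + d x az′ ≤ d x ax + K + d x ax′ →
            d z ax + K + d z ax′ < d z az + K′ + d z az′ →
            (atZ s₁ + atZ s₂) + (atX s₃ + atX s₄) < (atX s₁ + atX s₂) + (atZ s₃ + atZ s₄)
  count-< {az} {az′} {ax} {ax′} s₁ s₂ s₃ s₄ φx≤φx φz<φz = <-offset L<R (begin
    ((d x az + d x az′) + (d z ax + d z ax′)) + ((atX s₁ + atX s₂) + (atZ s₃ + atZ s₄))
      ≡⟨ +-interleave (d x az) (d x az′) (d z ax) (d z ax′) (atX s₁) (atX s₂) (atZ s₃) (atZ s₄) ⟩
    ((d x az + atX s₁) + (d x az′ + atX s₂)) + ((d z ax + atZ s₃) + (d z ax′ + atZ s₄))
      ≡⟨ cong₂ _+_ (cong₂ _+_ (balance s₁) (balance s₂)) (cong₂ _+_ (≡.sym (balance s₃)) (≡.sym (balance s₄))) ⟩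
    ((d z az + atZ s₁) + (d z az′ + atZ s₂)) + ((d x ax + atX s₃) + (d x ax′ + atX s₄))
      ≡⟨ ≡.sym (+-interleave (d z az) (d z az′) (d x ax) (d x ax′) (atZ s₁) (atZ s₂) (atX s₃) (atX s₄)) ⟩
    ((d z az + d z az′) + (d x ax + d x ax′)) + ((atZ s₁ + atZ s₂) + (atX s₃ + atX s₄)) ∎)
    where
    open ≡.≡-Reasoning
    L<R : (d x az + d x az′) + (d z ax + d z ax′) < (d z az + d z az′) + (d x ax + d x ax′)
    L<R = sum-of-bounds {d x az} {d x az′} {d x ax} {d x ax′} {d z ax} {d z ax′} {d z az} {d z az′} φx≤φx φz<φz

  separation : ∀ {az az′ ax ax′} (s₁ : Side az) (s₂ : Side az′) (s₃ : Side ax) (s₄ : Side ax′) →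
               (atZ s₁ + atZ s₂) + (atX s₃ + atX s₄) < (atX s₁ + atX s₂) + (atZ s₃ + atZ s₄) →
               (U x az × U x az′ × (U z ax ⊎ U z ax′)) ⊎ (U z ax × U z ax′ × (U x az ⊎ U x az′))
  separation (near-x u₁ _) (near-x u₂ _) (near-z u₃ _) _             _ = inj₁ (u₁ , u₂ , inj₁ u₃)
  separation (near-x u₁ _) (near-x u₂ _) (near-x _ _)  (near-z u₄ _) _ = inj₁ (u₁ , u₂ , inj₂ u₄)
  separation (near-x u₁ _) (near-z _ _)  (near-z u₃ _) (near-z u₄ _) _ = inj₂ (u₃ , u₄ , inj₁ u₁)
  separation (near-z _ _)  (near-x u₂ _) (near-z u₃ _) (near-z u₄ _) _ = inj₂ (u₃ , u₄ , inj₂ u₂)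
  separation (near-x _ _)  (near-x _ _)  (near-x _ _)  (near-x _ _)  h = ⊥-elim (≮-by-computation h)
  separation (near-x _ _)  (near-z _ _)  (near-x _ _)  (near-x _ _)  h = ⊥-elim (≮-by-computation h)
  separation (near-x _ _)  (near-z _ _)  (near-x _ _)  (near-z _ _)  h = ⊥-elim (≮-by-computation h)
  separation (near-x _ _)  (near-z _ _)  (near-z _ _)  (near-x _ _)  h = ⊥-elim (≮-by-computation h)
  separation (near-z _ _)  (near-x _ _)  (near-x _ _)  (near-x _ _)  h = ⊥-elim (≮-by-computation h)
  separation (near-z _ _)  (near-x _ _)  (near-x _ _)  (near-z _ _)  h = ⊥-elim (≮-by-computation h)
  separation (near-z _ _)  (near-x _ _)  (near-z _ _)  (near-x _ _)  h = ⊥-elim (≮-by-computation h)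
  separation (near-z _ _)  (near-z _ _)  (near-x _ _)  (near-x _ _)  h = ⊥-elim (≮-by-computation h)
  separation (near-z _ _)  (near-z _ _)  (near-x _ _)  (near-z _ _)  h = ⊥-elim (≮-by-computation h)
  separation (near-z _ _)  (near-z _ _)  (near-z _ _)  (near-x _ _)  h = ⊥-elim (≮-by-computation h)
  separation (near-z _ _)  (near-z _ _)  (near-z _ _)  (near-z _ _)  h = ⊥-elim (≮-by-computation h)

lemma1 : ∀ {n} (G T : Graph n) → TwoEdgeConnected G → IsSpanningTree G T →
         (d : Fin n → Fin n → ℕ) → IsTreeDist T d →
         (p q : Fin n) → Adj T p q →
         (X : Fin n → Set) →
         (∀ w → X w → Walk (removeEdge (Adj T) p q) p w) →
         (∀ w → Walk (removeEdge (Adj T) p q) p w → X w) →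
         (sel sel' : (x : Fin n) → X x → SwapEdge G X p q) →
         (∀ x (hx : X x) (g g' : SwapEdge G X p q) →
            φ d x g g' ≤ φ d x (sel x hx) (sel' x hx)) →
         ∀ x z (hx : X x) (hz : X z) → Adj T x z →
         φ d z (sel x hx) (sel' x hx) < φ d z (sel z hz) (sel' z hz) →
         let U : Fin n → Fin n → Set
             U c w = Walk (removeEdge (induced (Adj T) X) x z) c w
         in (U x (a (sel z hz)) × U x (a (sel' z hz)) ×
              (U z (a (sel x hx)) ⊎ U z (a (sel' x hx))))
            ⊎ (U z (a (sel x hx)) × U z (a (sel' x hx)) ×
              (U x (a (sel z hz)) ⊎ U x (a (sel' z hz))))
lemma1 G T _ (_ , _ , acyclic) d d-tree p q _ X reach inX sel sel' maximal x z x∈X z∈X xz φ<φ =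
  separation s₁ s₂ s₃ s₄ (count-< s₁ s₂ s₃ s₄ φx≤φx φz<φz)
  where
  open Tree.Distance T acyclic d d-tree
  open Sides T acyclic d d-tree X reach inX xz x∈X z∈X
  gx gx′ gz gz′ : SwapEdge G X p q
  gx = sel x x∈X
  gx′ = sel' x x∈X
  gz = sel z z∈X
  gz′ = sel' z z∈X
  s₁ : Side (a gz)
  s₁ = side (aX gz)
  s₂ : Side (a gz′)
  s₂ = side (aX gz′)
  s₃ : Side (a gx)
  s₃ = side (aX gx)
  s₄ : Side (a gx′)
  s₄ = side (aX gx′)
  φx≤φx : d x (a gz) + d (b gz) (b gz′) + d x (a gz′) ≤ d x (a gx) + d (b gx) (b gx′) + d x (a gx′)
  φx≤φx = subst₂ _≤_ (φ-unfold x gz gz′) (φ-unfold x gx gx′) (maximal x x∈X gz gz′)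
  φz<φz : d z (a gx) + d (b gx) (b gx′) + d z (a gx′) < d z (a gz) + d (b gz) (b gz′) + d z (a gz′)
  φz<φz = subst₂ _<_ (φ-unfold z gx gx′) (φ-unfold z gz gz′) φ<φ
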